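{- There exists an infinite family of permutations of $\mathbb{N}$ (bijections $\mathbb{N}\to\mathbb{N}$) such that for any two distinct members $x=(x_1,x_2,\dots)$ and $y=(y_1,y_2,\dots)$ of the family, the set $\{k\in\mathbb{N} : \text{there is a position } n \text{ with } |x_n-y_n|=k\}$ is infinite; equivalently, $x$ and $y$ are $L(k)$-different for infinitely many $k$.
   Context: An infinite permutation is a bijection $x:\mathbb{N}\to\mathbb{N}$, written as the sequence $(x_1,x_2,\dots)$, where $x_n$ is the entry in position $n$. For a graph $G$ with vertex set $\mathbb{N}$, two infinite permutations $x,y$ are $G$-different if for some position $n$ the entries $x_n,y_n$ are adjacent in $G$. For $k\ge 1$, $L(k)$ is the graph on $\mathbb{N}$ in which $i$ and $j$ are adjacent iff $|i-j|=k$. -}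

module Defs where

open import Data.Nat using (ℕ; _≥_; ∣_-_∣)
open import Data.Product using (∃; ∃-syntax; _×_)
open import Relation.Binary.PropositionalEquality using (_≡_)
open import Function.Bundles using (_↔_; Inverse)

Perm : Set
Perm = ℕ ↔ ℕ

L : ℕ → ℕ → ℕ → Set
L k i j = ∣ i - j ∣ ≡ k

L-different : ℕ → Perm → Perm → Set
L-different k x y = ∃[ n ] L k (Inverse.to x n) (Inverse.to y n)

InfinitelyManyLDifferent : Perm → Perm → Set
InfinitelyManyLDifferent x y = ∀ m → ∃[ k ] (k ≥ m × L-different k x y)

module Submission where

-- Split ℕ into evens and odds with the bijection
--   interleave : ℕ ⊎ ℕ ↔ ℕ,   inj₁ k ↦ 2k,  inj₂ k ↦ 2k+1.
-- A permutation f of ℕ can then be "run on the evens" (onEvens f) or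
-- "run on the odds" (onOdds f), fixing the other half.  Since doubling never
-- shrinks a distance,
--   * if f and g are separated (|f n - g n| unbounded), so are onOdds f and
--     onOdds g, and
--   * if f has unbounded displacement (|f n - n| unbounded), then onEvens f is
--     separated from every onOdds g, which fixes all even numbers.
-- A permutation τ with unbounded displacement comes from reassociating
-- ℕ ⊎ (ℕ ⊎ ℕ) ↔ (ℕ ⊎ ℕ) ⊎ ℕ; it sends 2m to 4m.  The family is
--   F 0 = onEvens τ,   F (i+1) = onOdds (F i),
-- and pairwise separation follows by induction on the two indices.  Being
-- separated is exactly being L(k)-different for unboundedly many k.

open import Defs
open import Data.Nat using (ℕ)
open import Data.Product using (Σ)
open import Relation.Binary.PropositionalEquality using (_≡_)
open import Relation.Nullary using (¬_)

open import Data.Nat using (zero; suc; _+_; _≤_; z≤n; s≤s; ∣_-_∣)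
open import Data.Nat.Properties using (≤-trans; n≤1+n; +-suc; ∣-∣-comm; ∣m-m+n∣≡n; module ≤-Reasoning)
open import Data.Product using (_,_; ∃)
open import Data.Sum using (_⊎_; inj₁; inj₂; [_,_])
open import Data.Sum.Algebra using (⊎-assoc)
open import Data.Sum.Function.Propositional using (_⊎-↔_)
open import Data.Empty using (⊥-elim)
open import Function using (_∘_)
open import Function.Bundles using (_↔_; mk↔ₛ′; Inverse)
open import Function.Construct.Composition using (_↔-∘_)
open import Function.Construct.Identity using (↔-id)
open import Function.Construct.Symmetry using (↔-sym)
open import Relation.Binary.PropositionalEquality using (refl; sym; cong; trans; subst; module ≡-Reasoning)

open Inverse using (to)

-- Doubling, by recursion so that double (suc k) reduces to suc (suc (double k)).
double : ℕ → ℕ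
double zero    = zero
double (suc k) = suc (suc (double k))

n≤double : ∀ n → n ≤ double n
n≤double zero    = z≤n
n≤double (suc n) = s≤s (≤-trans (n≤double n) (n≤1+n _))

∣double-double∣ : ∀ a b → ∣ double a - double b ∣ ≡ double ∣ a - b ∣
∣double-double∣ zero    zero    = refl
∣double-double∣ zero    (suc b) = refl
∣double-double∣ (suc a) zero    = refl
∣double-double∣ (suc a) (suc b) = ∣double-double∣ a b

dist≤dist-double : ∀ a b → ∣ a - b ∣ ≤ ∣ double a - double b ∣
dist≤dist-double a b = subst (∣ a - b ∣ ≤_) (sym (∣double-double∣ a b)) (n≤double _)

-- Doubling moves n by exactly n; this is what makes τ displace 2m by 2m.
double≡n+n : ∀ n → double n ≡ n + n
double≡n+n zero    = refl
double≡n+n (suc n) = cong suc (trans (cong suc (double≡n+n n)) (sym (+-suc n n)))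

∣double-n∣ : ∀ n → ∣ double n - n ∣ ≡ n
∣double-n∣ n = begin
  ∣ double n - n ∣ ≡⟨ cong (λ d → ∣ d - n ∣) (double≡n+n n) ⟩
  ∣ n + n - n ∣    ≡⟨ ∣-∣-comm (n + n) n ⟩
  ∣ n - n + n ∣    ≡⟨ ∣m-m+n∣≡n n n ⟩
  n                ∎
  where open ≡-Reasoning

merge : ℕ ⊎ ℕ → ℕ
merge = [ double , suc ∘ double ]

-- Its inverse, computed by walking up: 2k ↦ 2k+1 ↦ 2(k+1).
nextInSplit : ℕ ⊎ ℕ → ℕ ⊎ ℕ
nextInSplit (inj₁ k) = inj₂ k
nextInSplit (inj₂ k) = inj₁ (suc k)

split : ℕ → ℕ ⊎ ℕ
split zero    = inj₁ zero
split (suc n) = nextInSplit (split n)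

merge-next : ∀ s → merge (nextInSplit s) ≡ suc (merge s)
merge-next (inj₁ k) = refl
merge-next (inj₂ k) = refl

merge-split : ∀ n → merge (split n) ≡ n
merge-split zero    = refl
merge-split (suc n) = trans (merge-next (split n)) (cong suc (merge-split n))

split-double : ∀ k → split (double k) ≡ inj₁ k
split-double zero    = refl
split-double (suc k) = cong (nextInSplit ∘ nextInSplit) (split-double k)

split-merge : ∀ s → split (merge s) ≡ s
split-merge (inj₁ k) = split-double k
split-merge (inj₂ k) = cong nextInSplit (split-double k)

-- merge and split are mutually inverse, since both enumerate ℕ ⊎ ℕ in the
-- same order; split-double is the special case used to compute below.
interleave : (ℕ ⊎ ℕ) ↔ ℕ
interleave = mk↔ₛ′ merge split merge-split split-merge

onEvens onOdds : Perm → Perm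
onEvens f = interleave ↔-∘ ((f ⊎-↔ ↔-id ℕ) ↔-∘ ↔-sym interleave)
onOdds  f = interleave ↔-∘ ((↔-id ℕ ⊎-↔ f) ↔-∘ ↔-sym interleave)

onEvens-even : ∀ f k → to (onEvens f) (double k) ≡ double (to f k)
onEvens-even f k rewrite split-double k = refl

onOdds-even : ∀ f k → to (onOdds f) (double k) ≡ double k
onOdds-even f k rewrite split-double k = refl

onOdds-odd : ∀ f k → to (onOdds f) (suc (double k)) ≡ suc (double (to f k))
onOdds-odd f k rewrite split-double k = refl

-- Separation from the identity ↔-id ℕ means unbounded displacement.
Separated : Perm → Perm → Set
Separated f g = ∀ m → ∃ λ n → m ≤ ∣ to f n - to g n ∣

separated-sym : ∀ f g → Separated f g → Separated g f
separated-sym f g sep m with sep m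
... | n , m≤d = n , subst (m ≤_) (∣-∣-comm (to f n) (to g n)) m≤d

onOdds-separated : ∀ f g → Separated f g → Separated (onOdds f) (onOdds g)
onOdds-separated f g sep m with sep m
... | n , m≤d = suc (double n) , goal
  where
    goal : m ≤ ∣ to (onOdds f) (suc (double n)) - to (onOdds g) (suc (double n)) ∣
    goal rewrite onOdds-odd f n | onOdds-odd g n =
      ≤-trans m≤d (dist≤dist-double (to f n) (to g n))

-- A permutation of unbounded displacement, run on the evens, is separated
-- from anything run on the odds: the latter fixes every even number.
onEvens-onOdds-separated : ∀ f g → Separated f (↔-id ℕ) →
                           Separated (onEvens f) (onOdds g)
onEvens-onOdds-separated f g disp m with disp m
... | n , m≤d = double n , goal
  where
    goal : m ≤ ∣ to (onEvens f) (double n) - to (onOdds g) (double n) ∣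
    goal rewrite onEvens-even f n | onOdds-even g n =
      ≤-trans m≤d (dist≤dist-double (to f n) n)

-- The reassociation ℕ ↔ ℕ ⊎ (ℕ ⊎ ℕ) ↔ (ℕ ⊎ ℕ) ⊎ ℕ ↔ ℕ; it maps 2m to 4m.
τ : Perm
τ = interleave ↔-∘ ((interleave ⊎-↔ ↔-id ℕ) ↔-∘ (↔-sym (⊎-assoc _ ℕ ℕ ℕ)
      ↔-∘ ((↔-id ℕ ⊎-↔ ↔-sym interleave) ↔-∘ ↔-sym interleave)))

τ-double : ∀ m → to τ (double m) ≡ double (double m)
τ-double m rewrite split-double m = refl

-- Hence τ moves 2m by 2m ≥ m: its displacement is unbounded.
τ-displacement : Separated τ (↔-id ℕ)
τ-displacement m = double m , (begin
  m                                  ≡⟨ sym (∣double-n∣ m) ⟩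
  ∣ double m - m ∣                   ≤⟨ dist≤dist-double (double m) m ⟩
  ∣ double (double m) - double m ∣   ≡⟨ cong (λ t → ∣ t - double m ∣) (sym (τ-double m)) ⟩
  ∣ to τ (double m) - double m ∣     ∎)
  where open ≤-Reasoning

family : ℕ → Perm
family zero    = onEvens τ
family (suc i) = onOdds (family i)

family-separated : ∀ i j → ¬ i ≡ j → Separated (family i) (family j)
family-separated zero    zero    i≢j = ⊥-elim (i≢j refl)
family-separated zero    (suc j) i≢j = onEvens-onOdds-separated τ (family j) τ-displacement
family-separated (suc i) zero    i≢j =
  separated-sym (onEvens τ) (onOdds (family i))
    (onEvens-onOdds-separated τ (family i) τ-displacement)
family-separated (suc i) (suc j) i≢j =
  onOdds-separated (family i) (family j) (family-separated i j (i≢j ∘ cong suc))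

separated⇒infinitelyMany : ∀ f g → Separated f g → InfinitelyManyLDifferent f g
separated⇒infinitelyMany f g sep m with sep m
... | n , m≤d = _ , m≤d , n , refl

lemma1 : Σ (ℕ → Perm) λ F →
    (∀ i j → ¬ i ≡ j → InfinitelyManyLDifferent (F i) (F j))
lemma1 = family , λ i j i≢j →
  separated⇒infinitelyMany (family i) (family j) (family-separated i j i≢j)
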